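{- For a positive integer $M$ let $\mathcal S_M=\{[ij]\in\mathcal S: 0<j-i<M\}$. Let ${\bf x}=\sum_{J}a_J{\bf x}_J\in\mathcal A$, where $J$ runs over finite sequences of elements of $\mathcal S$, ${\bf x}_J$ is the corresponding word, and $a_J\in\mathbb Z$. If for every positive integer $M$ only finitely many sequences $J$ consisting solely of elements of $\mathcal S_M$ have $a_J\neq0$, then ${\bf x}$ gives a valid (well-defined) Bruhat action on $\mathbb A$, i.e. for each $w\in\widetilde S_n$ only finitely many terms $a_J\,A_w\cdot{\bf x}_J$ are nonzero.
   Context: Fix $n\ge2$. $\widetilde S_n$ is the affine symmetric group (bijections $w$ of $\mathbb Z$ with $w(i+n)=w(i)+n$, $\sum_{i=1}^n w(i)=\sum_{i=1}^n i$), with Coxeter generators $s_0,\dots,s_{n-1}$ and length $\ell$; for $i<j$, $i\not\equiv j\pmod n$, $t_{ij}$ is the element swapping $i+rn$ and $j+rn$ for all $r$. $\mathbb A$ is the affine nilCoxeter algebra with basis $A_w$, $w\in\widetilde S_n$ ($A_i^2=0$, braid relations; $A_w$ is the product along any reduced word). $\mathcal S$ is the set of symbols $[ij]$ with $i<j$ integers, $i\not\equiv j\pmod n$. $\mathcal A$ is the completion of the free algebra on $\mathcal S$ with respect to the filtration by subalgebras generated by $[ij]$ with $|i|,|j|\ge N$; its elements are formal possibly infinite integer combinations of finite words. The Bruhat action: $A_w\cdot[ij]=A_{wt_{ij}}$ if $\ell(wt_{ij})=\ell(w)-1$, and $0$ otherwise, extended multiplicatively to words and linearly. -}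

module Defs where

open import Data.Nat as ℕ using (ℕ; zero; suc; NonZero)
open import Data.Integer as ℤ using (ℤ; +_; _-_; _<_; _%ℕ_; ∣_∣)
open import Data.Fin using (Fin; toℕ)
open import Data.List using (List; []; _∷_; length)
open import Data.List.Relation.Unary.All using (All)
open import Data.List.Relation.Unary.Any using (Any)
open import Data.List.Membership.Propositional using (_∈_)
open import Data.Product using (Σ; ∃; _×_; _,_)
open import Data.Sum using (_⊎_)
open import Function using (_∘_; id; Injective)
open import Relation.Binary.PropositionalEquality using (_≡_; _≢_; _≗_)
open import Relation.Nullary using (¬_; does)
open import Data.Bool using (if_then_else_)

-- Throughout, n is the fixed integer n ≥ 2; functions take n with an
-- instance NonZero n (needed for residues mod n).

_≡[mod_]_ : ℤ → (n : ℕ) → .{{NonZero n}} → ℤ → Set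
(i ≡[mod n ] j) = (i %ℕ n) ≡ (j %ℕ n)

sum1 : ℕ → (ℤ → ℤ) → ℤ
sum1 zero    f = + 0
sum1 (suc k) f = sum1 k f ℤ.+ f (+ suc k)

record IsAffPerm (n : ℕ) (w : ℤ → ℤ) : Set where
  field
    injective  : ∀ x y → w x ≡ w y → x ≡ y
    surjective : ∀ y → ∃ λ x → w x ≡ y
    periodic   : ∀ i → w (i ℤ.+ + n) ≡ w i ℤ.+ + n
    sumCond    : sum1 n w ≡ sum1 n id

-- Coxeter generator s_i (0 ≤ i < n): swaps i+rn and i+1+rn for all r.
gen : (n : ℕ) → .{{NonZero n}} → Fin n → ℤ → ℤ
gen n i z =
  if does ((z %ℕ n) ℕ.≟ (+ toℕ i %ℕ n)) then z ℤ.+ + 1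
  else if does ((z %ℕ n) ℕ.≟ ((+ toℕ i ℤ.+ + 1) %ℕ n)) then z - + 1
  else z

wordProd : (n : ℕ) → .{{NonZero n}} → List (Fin n) → ℤ → ℤ
wordProd n []       = id
wordProd n (i ∷ is) = gen n i ∘ wordProd n is

HasLength : (n : ℕ) → .{{NonZero n}} → (ℤ → ℤ) → ℕ → Set
HasLength n w k =
  (Σ (List (Fin n)) λ u → length u ≡ k × wordProd n u ≗ w)
  × (∀ (u : List (Fin n)) → wordProd n u ≗ w → k ℕ.≤ length u)

-- Reflection t_{ij}: swaps i+rn and j+rn for all r.
refl-t : (n : ℕ) → .{{NonZero n}} → ℤ → ℤ → ℤ → ℤ
refl-t n i j z =
  if does ((z %ℕ n) ℕ.≟ (i %ℕ n)) then z ℤ.+ (j - i)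
  else if does ((z %ℕ n) ℕ.≟ (j %ℕ n)) then z - (j - i)
  else z

Sym : Set
Sym = ℤ × ℤ

ValidSym : (n : ℕ) → .{{NonZero n}} → Sym → Set
ValidSym n (i , j) = (i < j) × ¬ (i ≡[mod n ] j)

InSM : (n : ℕ) → .{{NonZero n}} → ℕ → Sym → Set
InSM n M (i , j) = ValidSym n (i , j) × (+ 0 < j - i) × (j - i < + M)

-- A formal combination x = Σ_J a_J x_J is given by its coefficient
-- function a on finite sequences J of symbols; a_J = 0 unless every
-- entry of J lies in 𝒮.
Supported : (n : ℕ) → .{{NonZero n}} → (List Sym → ℤ) → Set
Supported n a = ∀ J → a J ≢ + 0 → All (ValidSym n) J

FinitelyMany : (List Sym → Set) → Set
FinitelyMany P = Σ (List (List Sym)) λ L → ∀ J → P J → J ∈ L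

-- [ij] does not lie among the generators of the N-th filtration
-- subalgebra, i.e. |i| < N or |j| < N.
Small : ℕ → Sym → Set
Small N (i , j) = (∣ i ∣ ℕ.< N) ⊎ (∣ j ∣ ℕ.< N)

-- Σ a_J x_J converges in the completion 𝒜: for every N only finitely
-- many J with a_J ≠ 0 have x_J outside the subalgebra generated by the
-- [ij] with |i|,|j| ≥ N.
InCompletion : (List Sym → ℤ) → Set
InCompletion a = ∀ (N : ℕ) → FinitelyMany (λ J → a J ≢ + 0 × Any (Small N) J)

LengthDrop : (n : ℕ) → .{{NonZero n}} → (ℤ → ℤ) → (ℤ → ℤ) → Set
LengthDrop n u v = ∃ λ k → HasLength n u (suc k) × HasLength n v k

-- BruhatNZ n w J : A_w · x_J ≠ 0, where A_w·[ij] = A_{w t_ij} if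
-- ℓ(w t_ij) = ℓ(w) - 1 and 0 otherwise, applied letter by letter from
-- left to right (w t_ij = w ∘ t_ij as maps of ℤ).
data BruhatNZ (n : ℕ) .{{_ : NonZero n}} : (ℤ → ℤ) → List Sym → Set where
  done : ∀ {w} → BruhatNZ n w []
  step : ∀ {w i j J} →
         LengthDrop n w (w ∘ refl-t n i j) →
         BruhatNZ n (w ∘ refl-t n i j) J →
         BruhatNZ n w ((i , j) ∷ J)

module Submission where

-- Write w as a product of B generators.  A generator moves every integer
-- by at most 1, so a word of length L moves it by at most L.  If A_u·[ij] ≠ 0
-- then ℓ(u t_ij) = ℓ(u) - 1 =: k and u t_ij (i) = u(j), hence j - i ≤ 2k + 1 ≤ 2B.
-- Lengths only drop along A_w·x_J, so when A_w·x_J ≠ 0 all letters of J lie in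
-- 𝒮_M for M = 2B + 1 and the hypothesis applies.

open import Defs
open import Data.Nat as ℕ using (ℕ; zero; suc; NonZero; _≤_)
import Data.Nat.Properties as ℕP
import Data.Nat.DivMod as ℕD
import Data.Fin.Properties as FinP
open import Data.Integer as ℤ using (ℤ; +_; -[1+_]; _+_; _-_; _*_; -_; _%ℕ_; _/ℕ_)
  renaming (_≤_ to _≤ᶻ_; _<_ to _<ᶻ_)
import Data.Integer.Properties as ℤP
import Data.Integer.DivMod as ℤD
open import Data.Integer.Tactic.RingSolver using (solve-∀)
open import Data.Fin using (Fin; toℕ; fromℕ<)
open import Data.Bool using (if_then_else_)
open import Data.Empty using (⊥-elim)
open import Data.Sum using (_⊎_; inj₁; inj₂)
open import Data.Product using (Σ; _×_; _,_; proj₁; proj₂)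
open import Data.List using (List; []; _∷_; length; _++_)
open import Data.List.Relation.Unary.All as All using (All; []; _∷_)
open import Function using (_∘_; id)
open import Relation.Nullary using (¬_; Dec; yes; no; does)
open import Relation.Nullary.Decidable using (dec-true; dec-false)
open import Data.List.Membership.Propositional using (_∈_)
open import Relation.Binary.PropositionalEquality

swap : ∀ z a b → z + b + a ≡ z + a + b
swap = solve-∀

if-yes : ∀ {A P : Set} (d : Dec P) {x y : A} → P → (if does d then x else y) ≡ x
if-yes d {x} {y} p = cong (λ b → if b then x else y) (dec-true d p)

if-no : ∀ {A P : Set} (d : Dec P) {x y : A} → ¬ P → (if does d then x else y) ≡ y
if-no d {x} {y} ¬p = cong (λ b → if b then x else y) (dec-false d ¬p)

sum-cong : ∀ k f g → (∀ p → 1 ≤ p → p ≤ k → f (+ p) ≡ g (+ p)) → sum1 k f ≡ sum1 k g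
sum-cong zero    f g same = refl
sum-cong (suc k) f g same =
  cong₂ _+_ (sum-cong k f g (λ p 1≤p p≤k → same p 1≤p (ℕP.m≤n⇒m≤1+n p≤k)))
            (same (suc k) (ℕ.s≤s ℕ.z≤n) ℕP.≤-refl)

sum-nonneg : ∀ k f → (∀ z → + 0 ≤ᶻ f z) → + 0 ≤ᶻ sum1 k f
sum-nonneg zero    f f≥0 = ℤP.≤-refl
sum-nonneg (suc k) f f≥0 = ℤP.+-mono-≤ (sum-nonneg k f f≥0) (f≥0 (+ suc k))

AgreeOutside : ℕ → (ℕ → Set) → (ℤ → ℤ) → (ℤ → ℤ) → Set
AgreeOutside k X f g = ∀ p → 1 ≤ p → p ≤ k → ¬ X p → f (+ p) ≡ g (+ p)

sum-change-one : ∀ k f g P → 1 ≤ P → P ≤ k → AgreeOutside k (_≡ P) f g →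
                 sum1 k f ≡ sum1 k g + (f (+ P) - g (+ P))
sum-change-one zero    f g P 1≤P P≤0 agree = ⊥-elim (ℕP.<⇒≱ 1≤P P≤0)
sum-change-one (suc k) f g P 1≤P P≤k+1 agree with P ℕ.≟ suc k
... | yes refl = begin
  sum1 k f + f (+ P)                        ≡⟨ cong (_+ f (+ P)) (sum-cong k f g below-P) ⟩
  sum1 k g + f (+ P)                        ≡⟨ add-diff (sum1 k g) (f (+ P)) (g (+ P)) ⟩
  sum1 k g + g (+ P) + (f (+ P) - g (+ P))  ∎
  where
  open ≡-Reasoning
  add-diff : ∀ s a b → s + a ≡ s + b + (a - b)
  add-diff = solve-∀
  below-P : ∀ p → 1 ≤ p → p ≤ k → f (+ p) ≡ g (+ p)
  below-P p 1≤p p≤k = agree p 1≤p (ℕP.m≤n⇒m≤1+n p≤k) (ℕP.<⇒≢ (ℕ.s≤s p≤k))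
... | no P≢k+1 = begin
  sum1 k f + f (+ suc k)                                   ≡⟨ cong₂ _+_ earlier last ⟩
  sum1 k g + (f (+ P) - g (+ P)) + g (+ suc k)             ≡⟨ swap (sum1 k g) (g (+ suc k)) (f (+ P) - g (+ P)) ⟩
  sum1 k g + g (+ suc k) + (f (+ P) - g (+ P))             ∎
  where
  open ≡-Reasoning
  earlier : sum1 k f ≡ sum1 k g + (f (+ P) - g (+ P))
  earlier = sum-change-one k f g P 1≤P (ℕP.≤-pred (ℕP.≤∧≢⇒< P≤k+1 P≢k+1))
              (λ p 1≤p p≤k → agree p 1≤p (ℕP.m≤n⇒m≤1+n p≤k))
  last : f (+ suc k) ≡ g (+ suc k)
  last = agree (suc k) (ℕ.s≤s ℕ.z≤n) ℕP.≤-refl (P≢k+1 ∘ sym)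

-- Modifying f at two distinct points P, Q changes the sum by the two local
-- differences: pass through the function that equals f at P and g elsewhere.
sum-change-two : ∀ k f g P Q → 1 ≤ P → P ≤ k → 1 ≤ Q → Q ≤ k → P ≢ Q →
                 AgreeOutside k (λ p → p ≡ P ⊎ p ≡ Q) f g →
                 sum1 k f ≡ sum1 k g + (f (+ P) - g (+ P)) + (f (+ Q) - g (+ Q))
sum-change-two k f g P Q 1≤P P≤k 1≤Q Q≤k P≢Q agree = begin
  sum1 k f                                              ≡⟨ sum-change-one k f h Q 1≤Q Q≤k f≈h ⟩
  sum1 k h + (f (+ Q) - h (+ Q))                        ≡⟨ cong (_+ (f (+ Q) - h (+ Q))) (sum-change-one k h g P 1≤P P≤k h≈g) ⟩
  sum1 k g + (h (+ P) - g (+ P)) + (f (+ Q) - h (+ Q))  ≡⟨ cong₂ (λ a b → sum1 k g + (a - g (+ P)) + (f (+ Q) - b)) h-at-P h-at-Q ⟩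
  sum1 k g + (f (+ P) - g (+ P)) + (f (+ Q) - g (+ Q))  ∎
  where
  open ≡-Reasoning
  h : ℤ → ℤ
  h z = if does (z ℤ.≟ + P) then f z else g z
  h-at-P : h (+ P) ≡ f (+ P)
  h-at-P = if-yes (+ P ℤ.≟ + P) refl
  h-at-Q : h (+ Q) ≡ g (+ Q)
  h-at-Q = if-no (+ Q ℤ.≟ + P) (P≢Q ∘ sym ∘ ℤP.+-injective)
  h≈g : AgreeOutside k (_≡ P) h g
  h≈g p _ _ p≢P = if-no (+ p ℤ.≟ + P) (p≢P ∘ ℤP.+-injective)
  f≈h : AgreeOutside k (_≡ Q) f h
  f≈h p 1≤p p≤k p≢Q with + p ℤ.≟ + P
  ... | yes p≡P = sym (if-yes (+ p ℤ.≟ + P) p≡P)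
  ... | no p≢P  = trans (agree p 1≤p p≤k λ { (inj₁ p≡P) → p≢P (cong (+_) p≡P) ; (inj₂ p≡Q) → p≢Q p≡Q })
                        (sym (if-no (+ p ℤ.≟ + P) p≢P))

sum-translate : ∀ k c → sum1 k (λ z → z + c) ≡ sum1 k id + + k * c
sum-translate zero    c = sym (ℤP.+-identityʳ (+ 0))
sum-translate (suc k) c = trans (cong (_+ (+ suc k + c)) (sum-translate k c)) (regroup (sum1 k id) (+ k) c)
  where
  regroup : ∀ S a c → S + a * c + ((+ 1 + a) + c) ≡ S + (+ 1 + a) + (+ 1 + a) * c
  regroup = solve-∀

periodic-multiple : ∀ N (f : ℤ → ℤ) → (∀ z → f (z + + N) ≡ f z + + N) →
                    ∀ q z → f (z + q * + N) ≡ f z + q * + N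
periodic-multiple N f periodic (+ k) z = forward k z
  where
  one-more : ∀ z a c → z + (+ 1 + a) * c ≡ z + a * c + c
  one-more = solve-∀
  forward : ∀ k z → f (z + + k * + N) ≡ f z + + k * + N
  forward zero    z = trans (cong f (ℤP.+-identityʳ z)) (sym (ℤP.+-identityʳ (f z)))
  forward (suc k) z = begin
    f (z + + suc k * + N)        ≡⟨ cong f (one-more z (+ k) (+ N)) ⟩
    f (z + + k * + N + + N)      ≡⟨ periodic _ ⟩
    f (z + + k * + N) + + N      ≡⟨ cong (_+ + N) (forward k z) ⟩
    f z + + k * + N + + N        ≡⟨ sym (one-more (f z) (+ k) (+ N)) ⟩
    f z + + suc k * + N          ∎
    where open ≡-Reasoning
periodic-multiple N f periodic -[1+ k ] z = begin
  f (z + -[1+ k ] * + N)         ≡⟨ sym (cancel (f (z + -[1+ k ] * + N)) K) ⟩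
  f (z + -[1+ k ] * + N) + K - K ≡⟨ cong (_- K) (sym (periodic-multiple N f periodic (+ suc k) _)) ⟩
  f (z + -[1+ k ] * + N + K) - K ≡⟨ cong (λ t → f t - K) (back z (+ suc k) (+ N)) ⟩
  f z - K                        ≡⟨ neg (f z) (+ suc k) (+ N) ⟩
  f z + -[1+ k ] * + N           ∎
  where
  open ≡-Reasoning
  K = + suc k * + N
  cancel : ∀ a b → a + b - b ≡ a
  cancel = solve-∀
  back : ∀ z a c → z + (- a) * c + a * c ≡ z
  back = solve-∀
  neg : ∀ z a c → z - a * c ≡ z + (- a) * c
  neg = solve-∀

strict-rigid : ∀ (a : ℕ → ℤ) N → (∀ m → m ℕ.< N → a m <ᶻ a (suc m)) → a N ≡ a 0 + + N →
               ∀ m → m ≤ N → a m ≡ a 0 + + m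
strict-rigid a N increasing top m m≤N = ℤP.≤-antisym upper (climb 0 m m≤N)
  where
  climb : ∀ m d → m ℕ.+ d ≤ N → a m + + d ≤ᶻ a (m ℕ.+ d)
  climb m zero    _     = ℤP.≤-reflexive (trans (ℤP.+-identityʳ (a m)) (cong a (sym (ℕP.+-identityʳ m))))
  climb m (suc d) m+d<N = begin
    a m + + suc d               ≡⟨ sym (ℤP.+-assoc (a m) (+ 1) (+ d)) ⟩
    a m + + 1 + + d             ≡⟨ swap (a m) (+ d) (+ 1) ⟩
    a m + + d + + 1             ≤⟨ ℤP.+-monoˡ-≤ (+ 1) (climb m d (ℕP.<⇒≤ m+d<N')) ⟩
    a (m ℕ.+ d) + + 1           ≡⟨ ℤP.+-comm (a (m ℕ.+ d)) (+ 1) ⟩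
    + 1 + a (m ℕ.+ d)           ≤⟨ ℤP.i<j⇒suc[i]≤j (increasing (m ℕ.+ d) m+d<N') ⟩
    a (suc (m ℕ.+ d))           ≡⟨ cong a (sym (ℕP.+-suc m d)) ⟩
    a (m ℕ.+ suc d)             ∎
    where
    open ℤP.≤-Reasoning
    m+d<N' : m ℕ.+ d ℕ.< N
    m+d<N' = subst (ℕ._≤ N) (ℕP.+-suc m d) m+d<N
  d : ℕ
  d = N ℕ.∸ m
  m+d≡N : m ℕ.+ d ≡ N
  m+d≡N = ℕP.m+[n∸m]≡n m≤N
  upper : a m ≤ᶻ a 0 + + m
  upper = cancel-right (+ d) (begin
    a m + + d             ≤⟨ climb m d (ℕP.≤-reflexive m+d≡N) ⟩
    a (m ℕ.+ d)           ≡⟨ cong a m+d≡N ⟩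
    a N                   ≡⟨ top ⟩
    a 0 + + N             ≡⟨ cong (λ k → a 0 + + k) (sym m+d≡N) ⟩
    a 0 + + (m ℕ.+ d)     ≡⟨ sym (ℤP.+-assoc (a 0) (+ m) (+ d)) ⟩
    a 0 + + m + + d       ∎)
    where
    open ℤP.≤-Reasoning
    cancel-right : ∀ {x y} c → x + c ≤ᶻ y + c → x ≤ᶻ y
    cancel-right {x} {y} c le = subst₂ _≤ᶻ_ (add-sub x c) (add-sub y c) (ℤP.+-monoˡ-≤ (- c) le)
      where
      add-sub : ∀ x c → x + c - c ≡ x
      add-sub = solve-∀

module Residues (n : ℕ) .{{_ : NonZero n}} where

  positive-multiple-≥ : ∀ r b k → + r ≡ + b + + suc k * + n → n ≤ r
  positive-multiple-≥ r b k eq = begin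
      n                     ≤⟨ ℕP.m≤m+n n (k ℕ.* n) ⟩
      suc k ℕ.* n           ≤⟨ ℕP.m≤n+m _ b ⟩
      b ℕ.+ suc k ℕ.* n     ≡⟨ ℤP.+-injective (sym r≡) ⟩
      r                     ∎
    where
    open ℕP.≤-Reasoning
    r≡ : + r ≡ + (b ℕ.+ suc k ℕ.* n)
    r≡ = trans eq (cong (_+_ (+ b)) (sym (ℤP.pos-* (suc k) n)))

  residue-unique : ∀ r r' d → r ℕ.< n → r' ℕ.< n → + r ≡ + r' + d * + n → r ≡ r'
  residue-unique r r' (+ zero)   _   _    eq = ℤP.+-injective (trans eq (ℤP.+-identityʳ (+ r')))
  residue-unique r r' (+ suc k)  r<n _    eq =
    ⊥-elim (ℕP.<⇒≱ r<n (positive-multiple-≥ r r' k eq))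
  residue-unique r r' -[1+ k ]   _   r'<n eq =
    ⊥-elim (ℕP.<⇒≱ r'<n (positive-multiple-≥ r' r k (move (+ r) (+ r') -[1+ k ] eq)))
    where
    move : ∀ a b d → a ≡ b + d * + n → b ≡ a + (- d) * + n
    move a b d refl = cancel b d (+ n)
      where
      cancel : ∀ b d m → b ≡ b + d * m + (- d) * m
      cancel = solve-∀

  solve-for : ∀ a b c d m → a + b * m ≡ c + d * m → c ≡ a + (b - d) * m
  solve-for a b c d m eq = trans (shift c d m) (trans (cong (_- d * m) (sym eq)) (regroup a b d m))
    where
    shift : ∀ c d m → c ≡ c + d * m - d * m
    shift = solve-∀
    regroup : ∀ a b d m → a + b * m - d * m ≡ a + (b - d) * m
    regroup = solve-∀

  decompose : ∀ z → z ≡ + (z %ℕ n) + (z /ℕ n) * + n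
  decompose z = ℤD.a≡a%ℕn+[a/ℕn]*n z n

  collect : ∀ a b c m → a + b * m + c * m ≡ a + (b + c) * m
  collect = solve-∀

  mod-residue : ∀ r q → r ℕ.< n → (+ r + q * + n) %ℕ n ≡ r
  mod-residue r q r<n =
    residue-unique _ r (q - z /ℕ n) (ℤD.n%ℕd<d z n) r<n
      (solve-for (+ r) q (+ (z %ℕ n)) (z /ℕ n) (+ n) (decompose z))
    where
    z : ℤ
    z = + r + q * + n

  mod-shift : ∀ z q → (z + q * + n) %ℕ n ≡ z %ℕ n
  mod-shift z q = begin
    (z + q * + n) %ℕ n                               ≡⟨ cong (λ t → (t + q * + n) %ℕ n) (decompose z) ⟩
    (+ (z %ℕ n) + (z /ℕ n) * + n + q * + n) %ℕ n     ≡⟨ cong (_%ℕ n) (collect (+ (z %ℕ n)) (z /ℕ n) q (+ n)) ⟩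
    (+ (z %ℕ n) + (z /ℕ n + q) * + n) %ℕ n           ≡⟨ mod-residue (z %ℕ n) (z /ℕ n + q) (ℤD.n%ℕd<d z n) ⟩
    z %ℕ n                                           ∎
    where open ≡-Reasoning

  mod-shift-n : ∀ z → (z + + n) %ℕ n ≡ z %ℕ n
  mod-shift-n z = trans (cong (λ t → (z + t) %ℕ n) (sym (ℤP.*-identityˡ (+ n)))) (mod-shift z (+ 1))

  mod-suc : ∀ z → (z + + 1) %ℕ n ≡ suc (z %ℕ n) ℕ.% n
  mod-suc z = begin
    (z + + 1) %ℕ n                                 ≡⟨ cong (λ t → (t + + 1) %ℕ n) (decompose z) ⟩
    (+ r + q * + n + + 1) %ℕ n                     ≡⟨ cong (_%ℕ n) (regroup (+ r) q (+ n)) ⟩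
    (+ suc r + q * + n) %ℕ n                       ≡⟨ cong (_%ℕ n) r+1≡ ⟩
    (+ (r' ℕ.% n) + (+ (r' ℕ./ n) + q) * + n) %ℕ n ≡⟨ mod-residue (r' ℕ.% n) (+ (r' ℕ./ n) + q) (ℕD.m%n<n r' n) ⟩
    r' ℕ.% n                                       ∎
    where
    open ≡-Reasoning
    r r' : ℕ
    r = z %ℕ n
    r' = suc r
    q : ℤ
    q = z /ℕ n
    regroup : ∀ a b m → a + b * m + + 1 ≡ + 1 + a + b * m
    regroup = solve-∀
    r+1≡ : + r' + q * + n ≡ + (r' ℕ.% n) + (+ (r' ℕ./ n) + q) * + n
    r+1≡ = trans (cong (_+ q * + n) (decompose (+ r'))) (collect (+ (r' ℕ.% n)) (+ (r' ℕ./ n)) q (+ n))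

-- For n ≥ 2
-- these classes are distinct, which is what makes s_i an involution.
module Generators (n : ℕ) .{{_ : NonZero n}} (n≥2 : 2 ≤ n) where
  open Residues n

  data NextResidue (a : ℕ) : Set where
    inside : suc a ℕ.< n → suc a ℕ.% n ≡ suc a → NextResidue a
    wraps  : suc a ≡ n → suc a ℕ.% n ≡ 0 → NextResidue a

  next-residue : ∀ a → a ℕ.< n → NextResidue a
  next-residue a a<n with ℕP.m≤n⇒m<n∨m≡n a<n
  ... | inj₁ a+1<n = inside a+1<n (ℕD.m<n⇒m%n≡m a+1<n)
  ... | inj₂ a+1≡n = wraps a+1≡n (trans (cong (ℕ._% n) a+1≡n) (ℕD.n%n≡0 n))

  next-≢ : ∀ a → a ℕ.< n → suc a ℕ.% n ≢ a
  next-≢ a a<n with next-residue a a<n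
  ... | inside _ e    = λ p → ℕP.1+n≢n (trans (sym e) p)
  ... | wraps a+1≡n e = λ p → ℕP.<⇒≱ n≥2 (ℕP.≤-reflexive (trans (sym a+1≡n) (cong suc (trans (sym p) e))))

  next-injective : ∀ a b → a ℕ.< n → b ℕ.< n → suc a ℕ.% n ≡ suc b ℕ.% n → a ≡ b
  next-injective a b a<n b<n eq with next-residue a a<n | next-residue b b<n
  ... | inside _ ea | inside _ eb = ℕP.suc-injective (trans (sym ea) (trans eq eb))
  ... | inside _ ea | wraps _ eb  = ⊥-elim (ℕP.1+n≢0 (trans (sym ea) (trans eq eb)))
  ... | wraps _ ea  | inside _ eb = ⊥-elim (ℕP.1+n≢0 (trans (sym eb) (trans (sym eq) ea)))
  ... | wraps ea _  | wraps eb _  = ℕP.suc-injective (trans ea (sym eb))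

  module _ (i : Fin n) where
    private
      m : ℕ
      m = toℕ i
      m<n : m ℕ.< n
      m<n = FinP.toℕ<n i
      m%n≡m : m ℕ.% n ≡ m
      m%n≡m = ℕD.m<n⇒m%n≡m m<n
      m+1%n : (m ℕ.+ 1) ℕ.% n ≡ suc m ℕ.% n
      m+1%n = cong (ℕ._% n) (ℕP.+-comm m 1)

    gen-raise : ∀ z → z %ℕ n ≡ m → gen n i z ≡ z + + 1
    gen-raise z e = if-yes (z %ℕ n ℕ.≟ m ℕ.% n) (trans e (sym m%n≡m))

    gen-lower : ∀ z → z %ℕ n ≡ suc m ℕ.% n → gen n i z ≡ z - + 1
    gen-lower z e =
      trans (if-no (z %ℕ n ℕ.≟ m ℕ.% n) (λ p → next-≢ m m<n (trans (sym e) (trans p m%n≡m))))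
            (if-yes (z %ℕ n ℕ.≟ (m ℕ.+ 1) ℕ.% n) (trans e (sym m+1%n)))

    gen-fix : ∀ z → z %ℕ n ≢ m → z %ℕ n ≢ suc m ℕ.% n → gen n i z ≡ z
    gen-fix z ≢m ≢m+1 =
      trans (if-no (z %ℕ n ℕ.≟ m ℕ.% n) (λ p → ≢m (trans p m%n≡m)))
            (if-no (z %ℕ n ℕ.≟ (m ℕ.+ 1) ℕ.% n) (λ p → ≢m+1 (trans p m+1%n)))

    data GenCase (z : ℤ) : Set where
      raised  : z %ℕ n ≡ m → GenCase z
      lowered : z %ℕ n ≡ suc m ℕ.% n → GenCase z
      fixed   : z %ℕ n ≢ m → z %ℕ n ≢ suc m ℕ.% n → GenCase z

    gen-case : ∀ z → GenCase z
    gen-case z with z %ℕ n ℕ.≟ m | z %ℕ n ℕ.≟ suc m ℕ.% n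
    ... | yes e | _     = raised e
    ... | no _  | yes e = lowered e
    ... | no ≢m | no ≢m+1 = fixed ≢m ≢m+1

    -- s_i ∘ s_i = id: s_i moves the class of i up onto the class of i+1 and back.
    gen-involutive : ∀ z → gen n i (gen n i z) ≡ z
    gen-involutive z with gen-case z
    ... | raised e = begin
      gen n i (gen n i z)     ≡⟨ cong (gen n i) (gen-raise z e) ⟩
      gen n i (z + + 1)       ≡⟨ gen-lower (z + + 1) (trans (mod-suc z) (cong (λ r → suc r ℕ.% n) e)) ⟩
      z + + 1 - + 1           ≡⟨ add-sub z ⟩
      z                       ∎
      where
      open ≡-Reasoning
      add-sub : ∀ z → z + + 1 - + 1 ≡ z
      add-sub = solve-∀
    ... | lowered e = begin
      gen n i (gen n i z)     ≡⟨ cong (gen n i) (gen-lower z e) ⟩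
      gen n i (z - + 1)       ≡⟨ gen-raise (z - + 1) pred-residue ⟩
      z - + 1 + + 1           ≡⟨ sub-add z ⟩
      z                       ∎
      where
      open ≡-Reasoning
      sub-add : ∀ z → z - + 1 + + 1 ≡ z
      sub-add = solve-∀
      pred-residue : (z - + 1) %ℕ n ≡ m
      pred-residue = next-injective _ m (ℤD.n%ℕd<d (z - + 1) n) m<n
        (trans (sym (mod-suc (z - + 1))) (trans (cong (_%ℕ n) (sub-add z)) e))
    ... | fixed ≢m ≢m+1 = trans (cong (gen n i) (gen-fix z ≢m ≢m+1)) (gen-fix z ≢m ≢m+1)

    -- s_i(z + n) = s_i(z) + n, since the rule applied depends only on z mod n.
    gen-periodic : ∀ z → gen n i (z + + n) ≡ gen n i z + + n
    gen-periodic z with gen-case z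
    ... | raised e = trans (gen-raise (z + + n) (trans (mod-shift-n z) e))
                           (trans (swap z (+ 1) (+ n)) (cong (_+ + n) (sym (gen-raise z e))))
    ... | lowered e = trans (gen-lower (z + + n) (trans (mod-shift-n z) e))
                            (trans (swap z (- + 1) (+ n)) (cong (_+ + n) (sym (gen-lower z e))))
    ... | fixed ≢m ≢m+1 = trans (gen-fix (z + + n) (λ p → ≢m (trans (sym (mod-shift-n z)) p))
                                                  (λ p → ≢m+1 (trans (sym (mod-shift-n z)) p)))
                                (cong (_+ + n) (sym (gen-fix z ≢m ≢m+1)))

    gen-near : ∀ z → gen n i z ≤ᶻ z + + 1 × z ≤ᶻ gen n i z + + 1
    gen-near z with gen-case z
    ... | raised e  rewrite gen-raise z e = ℤP.≤-refl , ℤP.≤-trans (ℤP.i≤i+j z (+ 1)) (ℤP.i≤i+j (z + + 1) (+ 1))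
    ... | lowered e rewrite gen-lower z e = ℤP.≤-trans (ℤP.i-j≤i z (+ 1)) (ℤP.i≤i+j z (+ 1)) , ℤP.≤-reflexive (sym (sub-add z))
      where
      sub-add : ∀ z → z - + 1 + + 1 ≡ z
      sub-add = solve-∀
    ... | fixed ≢m ≢m+1 rewrite gen-fix z ≢m ≢m+1 = ℤP.i≤i+j z (+ 1) , ℤP.i≤i+j z (+ 1)

    -- The action of s_i on the window 1, …, n used by sum1.  For i ≠ 0 it swaps
    -- i and i+1; s_0 sends 1 to 0 and n to n+1.  All other points are fixed.
    gen-at-i : gen n i (+ m) ≡ + suc m
    gen-at-i = trans (gen-raise (+ m) m%n≡m) (cong +_ (ℕP.+-comm m 1))

    gen-at-i+1 : gen n i (+ suc m) ≡ + m
    gen-at-i+1 = gen-lower (+ suc m) refl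

    gen-at-n : m ≡ 0 → gen n i (+ n) ≡ + n + + 1
    gen-at-n m≡0 = gen-raise (+ n) (trans (ℕD.n%n≡0 n) (sym m≡0))

    gen-window-fixed : ∀ p → 1 ≤ p → p ≤ n → p ≢ m → p ≢ suc m → (m ≡ 0 → p ≢ n) → gen n i (+ p) ≡ + p
    gen-window-fixed p 1≤p p≤n p≢m p≢m+1 m≡0⇒p≢n with ℕP.m≤n⇒m<n∨m≡n p≤n | next-residue m m<n
    ... | inj₁ p<n | inside _ e = gen-fix (+ p) (λ q → p≢m (trans (sym res) q))
                                                (λ q → p≢m+1 (trans (sym res) (trans q e)))
      where
      res : p ℕ.% n ≡ p
      res = ℕD.m<n⇒m%n≡m p<n
    ... | inj₁ p<n | wraps _ e = gen-fix (+ p) (λ q → p≢m (trans (sym res) q))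
                                               (λ q → ℕP.<⇒≢ 1≤p (sym (trans (sym res) (trans q e))))
      where
      res : p ℕ.% n ≡ p
      res = ℕD.m<n⇒m%n≡m p<n
    ... | inj₂ p≡n | inside _ e = gen-fix (+ p) (λ q → m≡0⇒p≢n (sym (trans (sym res) q)) p≡n)
                                                (λ q → ℕP.1+n≢0 (sym (trans (sym res) (trans q e))))
      where
      res : p ℕ.% n ≡ 0
      res = trans (cong (ℕ._% n) p≡n) (ℕD.n%n≡0 n)
    ... | inj₂ p≡n | wraps m+1≡n _ = ⊥-elim (p≢m+1 (trans p≡n (sym m+1≡n)))

module Words (n : ℕ) .{{_ : NonZero n}} (n≥2 : 2 ≤ n) where
  open Generators n n≥2

  wordProd-++ : ∀ U V z → wordProd n (U ++ V) z ≡ wordProd n U (wordProd n V z)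
  wordProd-++ []      V z = refl
  wordProd-++ (i ∷ U) V z = cong (gen n i) (wordProd-++ U V z)

  word-near : ∀ U z → wordProd n U z ≤ᶻ z + + length U × z ≤ᶻ wordProd n U z + + length U
  word-near []      z = ℤP.≤-reflexive (sym (ℤP.+-identityʳ z)) , ℤP.≤-reflexive (sym (ℤP.+-identityʳ z))
  word-near (i ∷ U) z = upper , lower
    where
    y : ℤ
    y = wordProd n U z
    L : ℕ
    L = length U
    open ℤP.≤-Reasoning
    upper : gen n i y ≤ᶻ z + + suc L
    upper = begin
      gen n i y       ≤⟨ proj₁ (gen-near i y) ⟩
      y + + 1         ≤⟨ ℤP.+-monoˡ-≤ (+ 1) (proj₁ (word-near U z)) ⟩
      z + + L + + 1   ≡⟨ ℤP.+-assoc z (+ L) (+ 1) ⟩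
      z + (+ L + + 1) ≡⟨ cong (_+_ z) (ℤP.+-comm (+ L) (+ 1)) ⟩
      z + + suc L     ∎
    lower : z ≤ᶻ gen n i y + + suc L
    lower = begin
      z                         ≤⟨ proj₂ (word-near U z) ⟩
      y + + L                   ≤⟨ ℤP.+-monoˡ-≤ (+ L) (proj₂ (gen-near i y)) ⟩
      gen n i y + + 1 + + L     ≡⟨ ℤP.+-assoc (gen n i y) (+ 1) (+ L) ⟩
      gen n i y + + suc L       ∎

-- How a window sum Σ_{z=1}^n F(w z, z) changes when w is replaced by w ∘ s_i.
-- Only two window points move, so by sum-change-two the change is local.
module WindowSums (n : ℕ) .{{_ : NonZero n}} (n≥2 : 2 ≤ n) (F : ℤ → ℤ → ℤ) (w : ℤ → ℤ) (i : Fin n) where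
  open Generators n n≥2

  private
    m : ℕ
    m = toℕ i
    f g : ℤ → ℤ
    f z = F (w (gen n i z)) z
    g z = F (w z) z

  window-sum-swap : 1 ≤ m →
    sum1 n f ≡ sum1 n g + (F (w (+ suc m)) (+ m) - F (w (+ m)) (+ m))
                        + (F (w (+ m)) (+ suc m) - F (w (+ suc m)) (+ suc m))
  window-sum-swap 1≤m =
    trans (sum-change-two n f g m (suc m) 1≤m (ℕP.<⇒≤ m<n) (ℕ.s≤s ℕ.z≤n) m<n (ℕP.<⇒≢ ℕP.≤-refl) others)
          (cong₂ (λ a b → sum1 n g + (F (w a) (+ m) - g (+ m)) + (F (w b) (+ suc m) - g (+ suc m)))
                 (gen-at-i i) (gen-at-i+1 i))
    where
    m<n : m ℕ.< n
    m<n = FinP.toℕ<n i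
    others : AgreeOutside n (λ p → p ≡ m ⊎ p ≡ suc m) f g
    others p 1≤p p≤n p∉ = cong (λ z → F (w z) (+ p))
      (gen-window-fixed i p 1≤p p≤n (p∉ ∘ inj₁) (p∉ ∘ inj₂) (λ m≡0 → ⊥-elim (ℕP.<⇒≢ 1≤m (sym m≡0))))

  -- s_0 moves the window point 1 to 0 and n to n+1; for periodic w the new
  -- values are w(0) at 1 and w(1)+n at n, the old one at n is w(0)+n.
  window-sum-s₀ : (∀ z → w (z + + n) ≡ w z + + n) → m ≡ 0 →
    sum1 n f ≡ sum1 n g + (F (w (+ 0)) (+ 1) - F (w (+ 1)) (+ 1))
                        + (F (w (+ 1) + + n) (+ n) - F (w (+ 0) + + n) (+ n))
  window-sum-s₀ periodic m≡0 =
    trans (sum-change-two n f g 1 n ℕP.≤-refl 1≤n 1≤n ℕP.≤-refl (ℕP.<⇒≢ n≥2) others)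
          (trans (cong₂ (λ a b → sum1 n g + (F (w a) (+ 1) - g (+ 1)) + (F b (+ n) - g (+ n))) at-1 at-n)
                 (cong (λ c → sum1 n g + (F (w (+ 0)) (+ 1) - g (+ 1)) + (F (w (+ 1) + + n) (+ n) - F c (+ n)))
                       (periodic (+ 0))))
    where
    1≤n : 1 ≤ n
    1≤n = ℕP.<⇒≤ n≥2
    at-1 : gen n i (+ 1) ≡ + 0
    at-1 = subst (λ k → gen n i (+ suc k) ≡ + k) m≡0 (gen-at-i+1 i)
    at-n : w (gen n i (+ n)) ≡ w (+ 1) + + n
    at-n = trans (cong w (trans (gen-at-n i m≡0) (ℤP.+-comm (+ n) (+ 1)))) (periodic (+ 1))
    others : AgreeOutside n (λ p → p ≡ 1 ⊎ p ≡ n) f g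
    others p 1≤p p≤n p∉ = cong (λ z → F (w z) (+ p))
      (gen-window-fixed i p 1≤p p≤n (λ p≡m → ℕP.<⇒≢ 1≤p (sym (trans p≡m m≡0)))
                                    (λ p≡m+1 → p∉ (inj₁ (trans p≡m+1 (cong suc m≡0))))
                                    (λ _ → p∉ ∘ inj₂))

module Potential (n : ℕ) .{{_ : NonZero n}} (n≥2 : 2 ≤ n) where
  open Generators n n≥2
  open WindowSums n n≥2

  Periodic : (ℤ → ℤ) → Set
  Periodic w = ∀ z → w (z + + n) ≡ w z + + n

  Descent : (ℤ → ℤ) → Fin n → Set
  Descent w i = w (+ suc (toℕ i)) <ᶻ w (+ toℕ i)

  sq : ℤ → ℤ
  sq x = x * x

  Φ : (ℤ → ℤ) → ℤ
  Φ w = sum1 n (λ z → sq (w z - z))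

  Φ-nonneg : ∀ w → + 0 ≤ᶻ Φ w
  Φ-nonneg w = sum-nonneg n _ (λ z → sq-nonneg (w z - z))
    where
    sq-nonneg : ∀ x → + 0 ≤ᶻ sq x
    sq-nonneg (+ k)    = subst (+ 0 ≤ᶻ_) (ℤP.pos-* k k) (ℤ.+≤+ ℕ.z≤n)
    sq-nonneg -[1+ k ] = ℤ.+≤+ ℕ.z≤n

  Φ-step : ∀ w → Periodic w → ∀ i → Φ (w ∘ gen n i) ≡ Φ w + + 2 * (w (+ suc (toℕ i)) - w (+ toℕ i))
  Φ-step w periodic i with toℕ i ℕ.≟ 0
  ... | yes m≡0 = begin
    Φ (w ∘ gen n i)                                        ≡⟨ window-sum-s₀ (λ v z → sq (v - z)) w i periodic m≡0 ⟩
    Φ w + (sq (w (+ 0) - + 1) - sq (w (+ 1) - + 1))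
        + (sq (w (+ 1) + + n - + n) - sq (w (+ 0) + + n - + n)) ≡⟨ combine-s₀ (Φ w) (w (+ 0)) (w (+ 1)) (+ n) ⟩
    Φ w + + 2 * (w (+ 1) - w (+ 0))                        ≡⟨ cong (λ k → Φ w + + 2 * (w (+ suc k) - w (+ k))) (sym m≡0) ⟩
    Φ w + + 2 * (w (+ suc (toℕ i)) - w (+ toℕ i))          ∎
    where
    open ≡-Reasoning
    combine-s₀ : ∀ S x y c →
      S + ((x - + 1) * (x - + 1) - (y - + 1) * (y - + 1)) + ((y + c - c) * (y + c - c) - (x + c - c) * (x + c - c))
        ≡ S + + 2 * (y - x)
    combine-s₀ = solve-∀
  ... | no m≢0 = trans (window-sum-swap (λ v z → sq (v - z)) w i (ℕP.n≢0⇒n>0 m≢0))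
                       (combine-swap (Φ w) (w (+ toℕ i)) (w (+ suc (toℕ i))) (+ toℕ i))
    where
    combine-swap : ∀ S x y a →
      S + ((y - a) * (y - a) - (x - a) * (x - a)) + ((x - (+ 1 + a)) * (x - (+ 1 + a)) - (y - (+ 1 + a)) * (y - (+ 1 + a)))
        ≡ S + + 2 * (y - x)
    combine-swap = solve-∀

  Φ-descent : ∀ w → Periodic w → ∀ i → Descent w i → Φ (w ∘ gen n i) <ᶻ Φ w
  Φ-descent w periodic i descent = begin-strict
    Φ (w ∘ gen n i)                  ≡⟨ Φ-step w periodic i ⟩
    Φ w + + 2 * (y - x)              <⟨ ℤP.+-monoʳ-< (Φ w) twice-negative ⟩
    Φ w + + 0                        ≡⟨ ℤP.+-identityʳ (Φ w) ⟩
    Φ w                              ∎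
    where
    open ℤP.≤-Reasoning
    x y : ℤ
    x = w (+ toℕ i)
    y = w (+ suc (toℕ i))
    y-x<0 : y - x <ᶻ + 0
    y-x<0 = subst (y - x <ᶻ_) (ℤP.+-inverseʳ x) (ℤP.+-monoˡ-< (- x) descent)
    twice-negative : + 2 * (y - x) <ᶻ + 0
    twice-negative = subst (_<ᶻ + 0) (sym (double (y - x))) (ℤP.+-mono-< y-x<0 y-x<0)
      where
      double : ∀ t → + 2 * t ≡ t + t
      double = solve-∀

  sum-invariant : ∀ w → Periodic w → ∀ i → sum1 n (w ∘ gen n i) ≡ sum1 n w
  sum-invariant w periodic i with toℕ i ℕ.≟ 0
  ... | yes m≡0 = trans (window-sum-s₀ (λ v z → v) w i periodic m≡0)
                        (cancel-s₀ (sum1 n w) (w (+ 0)) (w (+ 1)) (+ n))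
    where
    cancel-s₀ : ∀ S x y c → S + (x - y) + ((y + c) - (x + c)) ≡ S
    cancel-s₀ = solve-∀
  ... | no m≢0 = trans (window-sum-swap (λ v z → v) w i (ℕP.n≢0⇒n>0 m≢0))
                       (cancel-swap (sum1 n w) (w (+ toℕ i)) (w (+ suc (toℕ i))))
    where
    cancel-swap : ∀ S x y → S + (y - x) + (x - y) ≡ S
    cancel-swap = solve-∀

  affine-gen : ∀ w → IsAffPerm n w → ∀ i → IsAffPerm n (w ∘ gen n i)
  affine-gen w aff i = record
    { injective  = λ x y e → trans (sym (gen-involutive i x))
                               (trans (cong (gen n i) (injective _ _ e)) (gen-involutive i y))
    ; surjective = λ y → let (x , wx≡y) = surjective y in
                         gen n i x , trans (cong w (gen-involutive i x)) wx≡y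
    ; periodic   = λ z → trans (cong w (gen-periodic i z)) (periodic (gen n i z))
    ; sumCond    = trans (sum-invariant w periodic i) sumCond
    }
    where open IsAffPerm aff

-- Every element of S̃_n is a product of generators: remove descents one at a
-- time; each removal lowers Φ ≥ 0, and without descents w is the identity.
module WordConstruction (n : ℕ) .{{_ : NonZero n}} (n≥2 : 2 ≤ n) where
  open Residues n
  open Generators n n≥2
  open Words n n≥2
  open Potential n n≥2

  -- An element of S̃_n without descents is the identity: w(0) < … < w(n) = w(0) + n
  -- forces w(m) = w(0) + m, the normalisation forces w(0) = 0, and periodicity
  -- extends w(r) = r from 0 ≤ r < n to all of ℤ.
  no-descent-identity : ∀ w → IsAffPerm n w → (∀ i → ¬ Descent w i) → ∀ z → z ≡ w z
  no-descent-identity w aff no-descent z = begin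
    z                         ≡⟨ decompose z ⟩
    + r + q * + n             ≡⟨ cong (_+ q * + n) (sym (fixes-residue r (ℕP.<⇒≤ (ℤD.n%ℕd<d z n)))) ⟩
    w (+ r) + q * + n         ≡⟨ sym (periodic-multiple n w periodic q (+ r)) ⟩
    w (+ r + q * + n)         ≡⟨ cong w (sym (decompose z)) ⟩
    w z                       ∎
    where
    open ≡-Reasoning
    open IsAffPerm aff
    r : ℕ
    r = z %ℕ n
    q c : ℤ
    q = z /ℕ n
    c = w (+ 0)
    increasing : ∀ m → m ℕ.< n → w (+ m) <ᶻ w (+ suc m)
    increasing m m<n = ℤP.≤∧≢⇒< (ℤP.≮⇒≥ not-descent)
                                 (λ e → ℕP.1+n≢n (sym (ℤP.+-injective (injective _ _ e))))
      where
      not-descent : ¬ (w (+ suc m) <ᶻ w (+ m))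
      not-descent = subst (λ k → ¬ (w (+ suc k) <ᶻ w (+ k))) (FinP.toℕ-fromℕ< m<n) (no-descent (fromℕ< m<n))
    on-window : ∀ m → m ≤ n → w (+ m) ≡ c + + m
    on-window = strict-rigid (λ m → w (+ m)) n increasing (periodic (+ 0))
    nc≡0 : + n * c ≡ + 0
    nc≡0 = left-cancel (sum1 n id) (+ n * c) (begin
      sum1 n id + + n * c     ≡⟨ sym (sum-translate n c) ⟩
      sum1 n (λ z → z + c)    ≡⟨ sum-cong n _ w (λ p _ p≤n → trans (ℤP.+-comm (+ p) c) (sym (on-window p p≤n))) ⟩
      sum1 n w                ≡⟨ sumCond ⟩
      sum1 n id               ∎)
      where
      left-cancel : ∀ S x → S + x ≡ S → x ≡ + 0
      left-cancel S x e = trans (add-sub S x) (trans (cong (_- S) e) (ℤP.+-inverseʳ S))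
        where
        add-sub : ∀ S x → x ≡ S + x - S
        add-sub = solve-∀
    c≡0 : c ≡ + 0
    c≡0 with ℤP.i*j≡0⇒i≡0∨j≡0 (+ n) nc≡0
    ... | inj₁ n≡0 = ⊥-elim (ℕP.<⇒≢ (ℕP.<-trans ℕP.0<1+n n≥2) (sym (ℤP.+-injective n≡0)))
    ... | inj₂ c≡0 = c≡0
    fixes-residue : ∀ m → m ≤ n → w (+ m) ≡ + m
    fixes-residue m m≤n = trans (on-window m m≤n) (trans (cong (_+ + m) c≡0) (ℤP.+-identityˡ (+ m)))

  -- Descend along Φ; fuel > |Φ(w)| bounds the number of steps.
  word-by-descent : ∀ fuel w → IsAffPerm n w → ℤ.∣ Φ w ∣ ℕ.< fuel → Σ (List (Fin n)) λ U → wordProd n U ≗ w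
  word-by-descent zero       w aff ()
  word-by-descent (suc fuel) w aff |Φ|<fuel with FinP.any? (λ i → w (+ suc (toℕ i)) ℤP.<? w (+ toℕ i))
  ... | no none = [] , no-descent-identity w aff (λ i d → none (i , d))
  ... | yes (i , descent) = U ++ (i ∷ []) , λ z →
          trans (wordProd-++ U (i ∷ []) z) (trans (U≗wsᵢ (gen n i z)) (cong w (gen-involutive i z)))
    where
    wsᵢ : ℤ → ℤ
    wsᵢ = w ∘ gen n i
    smaller : ℤ.∣ Φ wsᵢ ∣ ℕ.< fuel
    smaller = ℕP.<-≤-trans (abs-< (Φ-nonneg wsᵢ) (Φ-nonneg w) (Φ-descent w (IsAffPerm.periodic aff) i descent))
                           (ℕP.≤-pred |Φ|<fuel)
      where
      abs-< : ∀ {a b} → + 0 ≤ᶻ a → + 0 ≤ᶻ b → a <ᶻ b → ℤ.∣ a ∣ ℕ.< ℤ.∣ b ∣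
      abs-< 0≤a 0≤b a<b = ℤP.drop‿+<+ (subst₂ _<ᶻ_ (sym (ℤP.0≤i⇒+∣i∣≡i 0≤a)) (sym (ℤP.0≤i⇒+∣i∣≡i 0≤b)) a<b)
    rest : Σ (List (Fin n)) λ U → wordProd n U ≗ wsᵢ
    rest = word-by-descent fuel wsᵢ (affine-gen w aff i) smaller
    U : List (Fin n)
    U = proj₁ rest
    U≗wsᵢ : wordProd n U ≗ wsᵢ
    U≗wsᵢ = proj₂ rest

  word-of-affine : ∀ w → IsAffPerm n w → Σ (List (Fin n)) λ U → wordProd n U ≗ w
  word-of-affine w aff = word-by-descent (suc ℤ.∣ Φ w ∣) w aff ℕP.≤-refl

module BruhatSpan (n : ℕ) .{{_ : NonZero n}} (n≥2 : 2 ≤ n) where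
  open Words n n≥2

  SpanBelow : ℕ → Sym → Set
  SpanBelow M (i , j) = j - i <ᶻ + M

  valid-in-𝒮M : ∀ M {s} → ValidSym n s × SpanBelow M s → InSM n M s
  valid-in-𝒮M M {i , j} (valid , span) = valid , positive (proj₁ valid) , span
    where
    positive : i <ᶻ j → + 0 <ᶻ j - i
    positive i<j = subst (_<ᶻ j - i) (ℤP.+-inverseʳ i) (ℤP.+-monoˡ-< (- i) i<j)

  t-at-i : ∀ i j → refl-t n i j i ≡ j
  t-at-i i j = trans (if-yes (i %ℕ n ℕ.≟ i %ℕ n) refl) (cancel i j)
    where
    cancel : ∀ i j → i + (j - i) ≡ j
    cancel = solve-∀

  -- If ℓ(u) = k+1 and ℓ(u t_ij) = k then j - i ≤ 2k+1: indeed u t_ij (i) = u(j),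
  -- and reduced words move j and i by at most k+1 and k respectively.
  length-drop-span : ∀ u i j k → HasLength n u (suc k) → HasLength n (u ∘ refl-t n i j) k →
                     j - i ≤ᶻ + (k ℕ.+ suc k)
  length-drop-span u i j k ((U , |U| , U≗u) , _) ((V , |V| , V≗ut) , _) =
    ℤP.≤-trans (ℤP.+-monoˡ-≤ (- i) j≤) (ℤP.≤-reflexive (cancel i (+ (k ℕ.+ suc k))))
    where
    cancel : ∀ i c → i + c - i ≡ c
    cancel = solve-∀
    uj≡Vi : wordProd n U j ≡ wordProd n V i
    uj≡Vi = trans (U≗u j) (trans (cong u (sym (t-at-i i j))) (sym (V≗ut i)))
    open ℤP.≤-Reasoning
    j≤ : j ≤ᶻ i + + (k ℕ.+ suc k)
    j≤ = begin
      j                           ≤⟨ proj₂ (word-near U j) ⟩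
      wordProd n U j + + length U ≡⟨ cong₂ (λ a l → a + + l) uj≡Vi |U| ⟩
      wordProd n V i + + suc k    ≤⟨ ℤP.+-monoˡ-≤ (+ suc k) (proj₁ (word-near V i)) ⟩
      i + + length V + + suc k    ≡⟨ cong (λ l → i + + l + + suc k) |V| ⟩
      i + + k + + suc k           ≡⟨ ℤP.+-assoc i (+ k) (+ suc k) ⟩
      i + + (k ℕ.+ suc k)         ∎

  -- The length of the current element only decreases along
  -- the action, so the same B serves for every letter.
  bruhat-span : ∀ B u J → BruhatNZ n u J →
                (Σ (List (Fin n)) λ U → wordProd n U ≗ u × length U ≤ B) →
                All (SpanBelow (suc (B ℕ.+ B))) J
  bruhat-span B u []            done              _ = []
  bruhat-span B u ((i , j) ∷ J) (step (k , ℓu , ℓut@((V , |V| , V≗ut) , _)) rest) (U , U≗u , |U|≤B) =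
    span ∷ bruhat-span B (u ∘ refl-t n i j) J rest (V , V≗ut , ℕP.≤-trans (ℕP.≤-reflexive |V|) k≤B)
    where
    k+1≤B : suc k ≤ B
    k+1≤B = ℕP.≤-trans (proj₂ ℓu U U≗u) |U|≤B
    k≤B : k ≤ B
    k≤B = ℕP.≤-trans (ℕP.n≤1+n k) k+1≤B
    span : j - i <ᶻ + suc (B ℕ.+ B)
    span = ℤP.≤-<-trans (length-drop-span u i j k ℓu ℓut)
                        (ℤ.+<+ (ℕ.s≤s (ℕP.+-mono-≤ k≤B k+1≤B)))

theorem3p2 : (n : ℕ) → .{{_ : NonZero n}} → 2 ≤ n →
    (a : List Sym → ℤ) → Supported n a → InCompletion a →
    (∀ (M : ℕ) → 1 ≤ M → FinitelyMany (λ J → All (InSM n M) J × a J ≢ + 0)) →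
    ∀ (w : ℤ → ℤ) → IsAffPerm n w →
    FinitelyMany (λ J → a J ≢ + 0 × BruhatNZ n w J)
theorem3p2 n n≥2 a supported _ finite-in-𝒮 w aff = proj₁ finite-in-𝒮M , covered
  where
  open WordConstruction n n≥2
  open BruhatSpan n n≥2
  U : List (Fin n)
  U = proj₁ (word-of-affine w aff)
  B M : ℕ
  B = length U
  M = suc (B ℕ.+ B)
  finite-in-𝒮M : FinitelyMany (λ J → All (InSM n M) J × a J ≢ + 0)
  finite-in-𝒮M = finite-in-𝒮 M (ℕ.s≤s ℕ.z≤n)
  covered : ∀ J → a J ≢ + 0 × BruhatNZ n w J → J ∈ proj₁ finite-in-𝒮M
  covered J (aJ≢0 , nonzero) = proj₂ finite-in-𝒮M J (letters-in-𝒮M , aJ≢0)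
    where
    spans : All (SpanBelow M) J
    spans = bruhat-span B w J nonzero (U , proj₂ (word-of-affine w aff) , ℕP.≤-refl)
    letters-in-𝒮M : All (InSM n M) J
    letters-in-𝒮M = All.zipWith (valid-in-𝒮M M) (supported J aJ≢0 , spans)
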